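{- Let $M$ be a bounded model with least element $0$ and greatest element $1$. Then for every formula $\varphi$: (1) $(M,1)\models\varphi$; (2) $(M,0)\not\models\varphi$.
   Context: Language: a countable set $Pr$ of propositional variables, binary connectives $\land,\lor,\to$ and unary connectives $\neg,\Box,\Box_L$. A frame is $F=(S,\leq,R,*,Q,Q_L)$ where $(S,\leq)$ is a partially ordered set; $R\subseteq S^3$ satisfies: if $Rstu$, $s'\leq s$, $t'\leq t$ and $u\leq u'$ then $Rs't'u'$; $*:S\to S$ satisfies $s\leq t\Rightarrow t^*\leq s^*$; $Q,Q_L\subseteq S^2$ satisfy: if $Qst$, $s'\leq s$, $t\leq t'$ then $Qs't'$ (same for $Q_L$). A valuation $V$ assigns to each $p\in Pr$ an up-set of $(S,\leq)$. The interpretation: $[\![p]\!]=V(p)$; $\land$ is intersection, $\lor$ is union; $[\![\neg\varphi]\!]=\{s: s^*\notin[\![\varphi]\!]\}$; $[\![\varphi\to\psi]\!]=\{s:\forall t,u\,(Rstu \text{ and } t\in[\![\varphi]\!]\Rightarrow u\in[\![\psi]\!])\}$; $[\![\Box\varphi]\!]=\{s:\forall t\,(Qst\Rightarrow t\in[\![\varphi]\!])\}$; $[\![\Box_L\varphi]\!]$ likewise with $Q_L$. Write $(M,s)\models\varphi$ for $s\in[\![\varphi]\!]$. A frame is bounded if $(S,\leq)$ has a least element $0$ and greatest element $1$ and: $1^*=0$, $0^*=1$; $Q00$ and $Q_L00$; $Q1s\Rightarrow s=1$ and $Q_L1s\Rightarrow s=1$; $R010$; and $R1st\Rightarrow (s=0$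 or $t=1)$. A bounded model is a frame-plus-valuation where the frame is bounded and $0\notin V(p)$, $1\in V(p)$ for all $p\in Pr$. -}

module Defs where

open import Data.Nat using (ℕ)
open import Data.Product using (_×_; Σ)
open import Data.Sum using (_⊎_)
open import Relation.Binary.PropositionalEquality using (_≡_)
open import Relation.Nullary using (¬_)

Pr : Set
Pr = ℕ

data Formula : Set where
  var  : Pr → Formula
  _∧_  : Formula → Formula → Formula
  _∨_  : Formula → Formula → Formula
  _⇒_  : Formula → Formula → Formula
  ¬'_  : Formula → Formula
  □_   : Formula → Formula
  □L_  : Formula → Formula

record Frame : Set₁ where
  field
    S      : Set
    _≤_    : S → S → Set
    ≤-refl  : ∀ {s} → s ≤ s
    ≤-antisym : ∀ {s t} → s ≤ t → t ≤ s → s ≡ t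
    ≤-trans : ∀ {s t u} → s ≤ t → t ≤ u → s ≤ u
    R      : S → S → S → Set
    R-mono : ∀ {s t u s' t' u'} → R s t u → s' ≤ s → t' ≤ t → u ≤ u' → R s' t' u'
    _*     : S → S
    *-anti : ∀ {s t} → s ≤ t → (t *) ≤ (s *)
    Q      : S → S → Set
    Q-mono : ∀ {s t s' t'} → Q s t → s' ≤ s → t ≤ t' → Q s' t'
    QL     : S → S → Set
    QL-mono : ∀ {s t s' t'} → QL s t → s' ≤ s → t ≤ t' → QL s' t'

record UpSet (F : Frame) : Set₁ where
  open Frame F
  field
    mem   : S → Set
    upward : ∀ {s t} → s ≤ t → mem s → mem t

Valuation : Frame → Set₁
Valuation F = Pr → UpSet F

record Model : Set₁ where
  field
    frame : Frame
    V     : Valuation frame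

_,_⊨_ : (M : Model) → Frame.S (Model.frame M) → Formula → Set
M , s ⊨ var p   = UpSet.mem (Model.V M p) s
M , s ⊨ (φ ∧ ψ) = (M , s ⊨ φ) × (M , s ⊨ ψ)
M , s ⊨ (φ ∨ ψ) = (M , s ⊨ φ) ⊎ (M , s ⊨ ψ)
M , s ⊨ (φ ⇒ ψ) = ∀ t u → Frame.R (Model.frame M) s t u → M , t ⊨ φ → M , u ⊨ ψ
M , s ⊨ (¬' φ)  = ¬ (M , Frame._* (Model.frame M) s ⊨ φ)
M , s ⊨ (□ φ)   = ∀ t → Frame.Q (Model.frame M) s t → M , t ⊨ φ
M , s ⊨ (□L φ)  = ∀ t → Frame.QL (Model.frame M) s t → M , t ⊨ φ

record IsBounded (F : Frame) (𝟘 𝟙 : Frame.S F) : Set where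
  open Frame F
  field
    least    : ∀ s → 𝟘 ≤ s
    greatest : ∀ s → s ≤ 𝟙
    1*≡0     : (𝟙 *) ≡ 𝟘
    0*≡1     : (𝟘 *) ≡ 𝟙
    Q00      : Q 𝟘 𝟘
    QL00     : QL 𝟘 𝟘
    Q1       : ∀ s → Q 𝟙 s → s ≡ 𝟙
    QL1      : ∀ s → QL 𝟙 s → s ≡ 𝟙
    R010     : R 𝟘 𝟙 𝟘
    R1       : ∀ s t → R 𝟙 s t → (s ≡ 𝟘) ⊎ (t ≡ 𝟙)

record IsBoundedModel (M : Model) (𝟘 𝟙 : Frame.S (Model.frame M)) : Set where
  field
    bounded : IsBounded (Model.frame M) 𝟘 𝟙
    V0      : ∀ p → ¬ UpSet.mem (Model.V M p) 𝟘
    V1      : ∀ p → UpSet.mem (Model.V M p) 𝟙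

{-# OPTIONS --safe #-}
-- Both parts are proved by one simultaneous induction on φ: negation swaps 1 and 0,
-- and an implication is refuted at 0 through R 0 1 0, so each part needs the other
-- on subformulas.
module Submission where

open import Defs
open import Data.Empty using (⊥-elim)
open import Data.Product using (_×_; _,_)
open import Data.Sum using (inj₁; inj₂)
open import Relation.Nullary using (¬_)
open import Relation.Binary.PropositionalEquality using (_≡_; subst; sym)

⊨-resp-≡ : ∀ {M} φ {s t : Frame.S (Model.frame M)} → s ≡ t → M , s ⊨ φ → M , t ⊨ φ
⊨-resp-≡ {M} φ = subst (M ,_⊨ φ)

module BoundedModel (M : Model) {𝟘 𝟙 : Frame.S (Model.frame M)} (bm : IsBoundedModel M 𝟘 𝟙) where
  open IsBoundedModel bm
  open IsBounded bounded

  mutual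
    top-⊨ : ∀ φ → M , 𝟙 ⊨ φ
    top-⊨ (var p) = V1 p
    top-⊨ (φ ∧ ψ) = top-⊨ φ , top-⊨ ψ
    top-⊨ (φ ∨ ψ) = inj₁ (top-⊨ φ)
    top-⊨ (φ ⇒ ψ) t u r t⊨φ with R1 t u r
    ... | inj₁ t≡𝟘 = ⊥-elim (bottom-⊭ φ (⊨-resp-≡ φ t≡𝟘 t⊨φ))
    ... | inj₂ u≡𝟙 = ⊨-resp-≡ ψ (sym u≡𝟙) (top-⊨ ψ)
    top-⊨ (¬' φ) 𝟙*⊨φ = bottom-⊭ φ (⊨-resp-≡ φ 1*≡0 𝟙*⊨φ)
    top-⊨ (□ φ) t q = ⊨-resp-≡ φ (sym (Q1 t q)) (top-⊨ φ)
    top-⊨ (□L φ) t q = ⊨-resp-≡ φ (sym (QL1 t q)) (top-⊨ φ)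

    bottom-⊭ : ∀ φ → ¬ (M , 𝟘 ⊨ φ)
    bottom-⊭ (var p) = V0 p
    bottom-⊭ (φ ∧ ψ) (𝟘⊨φ , _) = bottom-⊭ φ 𝟘⊨φ
    bottom-⊭ (φ ∨ ψ) (inj₁ 𝟘⊨φ) = bottom-⊭ φ 𝟘⊨φ
    bottom-⊭ (φ ∨ ψ) (inj₂ 𝟘⊨ψ) = bottom-⊭ ψ 𝟘⊨ψ
    bottom-⊭ (φ ⇒ ψ) 𝟘⊨φ⇒ψ = bottom-⊭ ψ (𝟘⊨φ⇒ψ 𝟙 𝟘 R010 (top-⊨ φ))
    bottom-⊭ (¬' φ) 𝟘⊨¬φ = 𝟘⊨¬φ (⊨-resp-≡ φ (sym 0*≡1) (top-⊨ φ))
    bottom-⊭ (□ φ) 𝟘⊨□φ = bottom-⊭ φ (𝟘⊨□φ 𝟘 Q00)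
    bottom-⊭ (□L φ) 𝟘⊨□φ = bottom-⊭ φ (𝟘⊨□φ 𝟘 QL00)

lemma4p2 : (M : Model) (𝟘 𝟙 : Frame.S (Model.frame M)) → IsBoundedModel M 𝟘 𝟙 → (φ : Formula) → (M , 𝟙 ⊨ φ) × (¬ (M , 𝟘 ⊨ φ))
lemma4p2 M 𝟘 𝟙 bm φ = top-⊨ φ , bottom-⊭ φ
  where open BoundedModel M bm
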